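{- If the bin capacity is $h=2$ and the number of colors equals the number $n$ of full bins ($|C|=n$), then every yes-instance of $\mathrm{WSP}$ can be transformed into a sorted configuration by a sequence of $O(n)$ water-moves.
   Context: Setting: $B$ is a finite set of bins, each of capacity $h$, and $C$ a finite set of colors. A configuration is a map $S$ assigning to each bin $b$ a sequence $S(b)$ of colors of length at most $h$, listed from bottom to top; the last element is the top unit. An instance is a configuration in which $n$ bins are full (length $h$) and $k$ bins are empty, and each color occurs exactly $hj$ times for some positive integer $j$. A configuration is sorted if every bin is either empty or contains $h$ units all of the same color. Water-move: choose distinct bins $b_1,b_2$, a color $c$ and $m\ge1$ such that $S(b_1)$ ends with $c^m$, $S(b_2)$ is empty or has top color $c$, and $|S(b_2)|+m\le h$; remove those $m$ units from the top of $b_1$ and put them on top of $b_2$, where after the move either the new top of $b_1$ is not $c$ (or $b_1$ is empty) or $b_2$ is full. $\mathrm{WSP}$: given an instance, decide whether it can be transformed into a sorted configuration by a finite sequence of water-moves; a yes-instance is one for which this is possible. -}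

module Defs where

open import Data.Nat using (ℕ; zero; suc; _+_; _*_; _≤_)
open import Data.Nat.Properties using () renaming (_≟_ to _≟ℕ_)
open import Data.Fin using (Fin)
open import Data.Fin.Properties using () renaming (_≟_ to _≟F_)
open import Data.List using (List; []; _∷_; _++_; [_]; replicate; length; filter; map; allFin)
open import Data.Nat.ListAction using (sum)
open import Data.Product using (Σ; ∃; ∃-syntax; _×_; _,_)
open import Data.Sum using (_⊎_)
open import Relation.Nullary using (¬_)
open import Relation.Binary.PropositionalEquality using (_≡_; _≢_)

-- A configuration on the bin set B = Fin m with colour set C = Fin c:
-- each bin holds a list of colours, listed from bottom to top (last = top).
Config : ℕ → ℕ → Set
Config m c = Fin m → List (Fin c)

TopIs : ∀ {c} → List (Fin c) → Fin c → Set
TopIs xs col = ∃[ ys ] xs ≡ ys ++ [ col ]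

record WaterMove {m c : ℕ} (h : ℕ) (S S' : Config m c) : Set where
  field
    b₁ b₂  : Fin m
    distinct : b₁ ≢ b₂
    col    : Fin c
    k      : ℕ
    pre    : List (Fin c)
    k≥1    : 1 ≤ k
    src    : S b₁ ≡ pre ++ replicate k col
    tgtOK  : S b₂ ≡ [] ⊎ TopIs (S b₂) col
    fits   : length (S b₂) + k ≤ h
    newSrc : S' b₁ ≡ pre
    newTgt : S' b₂ ≡ S b₂ ++ replicate k col
    others : ∀ b → b ≢ b₁ → b ≢ b₂ → S' b ≡ S b
    maximal : ¬ TopIs pre col ⊎ length (S' b₂) ≡ h

data Moves {m c : ℕ} (h : ℕ) : ℕ → Config m c → Config m c → Set where
  done : ∀ {S} → Moves h 0 S S
  step : ∀ {l S S' S''} → WaterMove h S S' → Moves h l S' S'' → Moves h (suc l) S S''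

Sorted : ∀ {m c} → ℕ → Config m c → Set
Sorted {m} {c} h S = ∀ (b : Fin m) → S b ≡ [] ⊎ ∃[ col ] S b ≡ replicate h col

numFull : ∀ {m c} → ℕ → Config m c → ℕ
numFull {m} h S = length (filter (λ b → length (S b) ≟ℕ h) (allFin m))

numEmpty : ∀ {m c} → Config m c → ℕ
numEmpty {m} S = length (filter (λ b → length (S b) ≟ℕ 0) (allFin m))

occ : ∀ {m c} → Config m c → Fin c → ℕ
occ {m} S col = sum (map (λ b → length (filter (_≟F col) (S b))) (allFin m))

record IsInstance {m c : ℕ} (h n k : ℕ) (S : Config m c) : Set where
  field
    fullOrEmpty : ∀ b → length (S b) ≡ h ⊎ length (S b) ≡ 0
    nFull  : numFull h S ≡ n
    kEmpty : numEmpty S ≡ k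
    colourCount : ∀ col → ∃[ j ] (1 ≤ j × occ S col ≡ h * j)

Solvable : ∀ {m c} → ℕ → Config m c → Set
Solvable h S = ∃[ l ] ∃[ S' ] (Moves h l S S' × Sorted h S')

{-# OPTIONS --safe #-}
module Submission where

open import Defs
open import Algebra.Properties.CommutativeSemigroup using (x∙yz≈y∙xz)
open import Data.Bool using (true; false; if_then_else_)
open import Data.Empty using (⊥-elim)
open import Data.Fin using (Fin; zero; suc)
open import Data.Fin.Permutation using (Permutation′; _⟨$⟩ʳ_; _⟨$⟩ˡ_; inverseˡ; inverseʳ; transpose)
open import Data.Fin.Properties using (_≟_)
open import Data.List using (List; []; _∷_; _++_; [_]; replicate; length; filter; map; allFin; tabulate)
open import Data.List.Properties using (length-++; length-replicate; length-++-≤ˡ; map-tabulate)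
open import Data.Nat using (ℕ; zero; suc; _+_; _*_; _≤_; _<_; z≤n; s≤s)
open import Data.Nat.ListAction using () renaming (sum to listSum)
open import Data.Nat.Properties
  using (+-0-commutativeMonoid; +-commutativeSemigroup; +-assoc; +-identityʳ; *-suc; +-mono-≤; +-monoˡ-<;
         m+n≤o⇒n≤o; ≤-refl; ≤-trans; ≤-reflexive; module ≤-Reasoning)
  renaming (_≟_ to _≟ℕ_)
open import Algebra.Properties.CommutativeMonoid.Sum +-0-commutativeMonoid using (sum; sum-cong-≗; sum-permute)
open import Data.Product using (∃-syntax; _×_; _,_)
open import Data.Sum using (_⊎_; inj₁; inj₂; map₂)
open import Data.Vec.Functional using (Vector; updateAt)
open import Data.Vec.Functional.Properties using (updateAt-updates; updateAt-minimal)
open import Function using (_∘_; id; const)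
open import Relation.Nullary using (¬_; Dec; yes; no; does)
open import Relation.Nullary.Decidable using (dec-true; dec-false)
open import Relation.Unary using (Pred; Decidable)
open import Relation.Binary.PropositionalEquality
  using (_≡_; _≢_; _≗_; refl; sym; trans; cong; subst; subst₂; module ≡-Reasoning)

-- Give each bin a potential: 0 if it is empty or sorted, 1 if it holds one unit, and 3 if it
-- holds two different colours. With capacity 2, a water-move either strictly lowers the total
-- potential or merely exchanges the contents of its two bins, and a move of the second kind can
-- be deleted by relabelling the bins in the rest of the sequence. Hence every sorting sequence
-- shortens to one with at most as many moves as the initial potential, which is at most 3n.
-- Neither the number of colours nor the colour multiplicities enter the bound.

binPotential : ∀ {c} → List (Fin c) → ℕ
binPotential []              = 0
binPotential (_ ∷ [])        = 1
binPotential (x ∷ y ∷ [])    = if does (x ≟ y) then 0 else 3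
binPotential (_ ∷ _ ∷ _ ∷ _) = 0

binPotential≤3 : ∀ {c} (xs : List (Fin c)) → binPotential xs ≤ 3
binPotential≤3 []              = z≤n
binPotential≤3 (_ ∷ [])        = s≤s z≤n
binPotential≤3 (x ∷ y ∷ []) with does (x ≟ y)
... | true  = z≤n
... | false = ≤-refl
binPotential≤3 (_ ∷ _ ∷ _ ∷ _) = z≤n

binPotential-sorted : ∀ {c} (x : Fin c) → binPotential (x ∷ x ∷ []) ≡ 0
binPotential-sorted x rewrite dec-true (x ≟ x) refl = refl

binPotential-mixed : ∀ {c} {x y : Fin c} → x ≢ y → binPotential (x ∷ y ∷ []) ≡ 3
binPotential-mixed {x = x} {y} x≢y rewrite dec-false (x ≟ y) x≢y = refl

potential : ∀ {m c} → Config m c → ℕ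
potential S = sum (binPotential ∘ S)

zeroAt : ∀ {n} → Vector ℕ n → Fin n → Vector ℕ n
zeroAt xs i = updateAt xs i (const 0)

sum-zeroAt : ∀ {n} (xs : Vector ℕ n) i → sum xs ≡ xs i + sum (zeroAt xs i)
sum-zeroAt xs zero    = refl
sum-zeroAt xs (suc i) = begin
  xs zero + sum (xs ∘ suc)               ≡⟨ cong (xs zero +_) (sum-zeroAt (xs ∘ suc) i) ⟩
  xs zero + (xs (suc i) + rest)          ≡⟨ x∙yz≈y∙xz +-commutativeSemigroup (xs zero) (xs (suc i)) rest ⟩
  xs (suc i) + (xs zero + rest)          ∎
  where
  open ≡-Reasoning
  rest = sum (zeroAt (xs ∘ suc) i)

sum-zeroAt₂ : ∀ {n} (xs : Vector ℕ n) {i j} → i ≢ j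
  → sum xs ≡ (xs i + xs j) + sum (zeroAt (zeroAt xs i) j)
sum-zeroAt₂ xs {i} {j} i≢j = begin
  sum xs                                 ≡⟨ sum-zeroAt xs i ⟩
  xs i + sum (zeroAt xs i)               ≡⟨ cong (xs i +_) (sum-zeroAt (zeroAt xs i) j) ⟩
  xs i + (zeroAt xs i j + rest)          ≡⟨ cong (λ x → xs i + (x + rest)) (updateAt-minimal j i xs (i≢j ∘ sym)) ⟩
  xs i + (xs j + rest)                   ≡⟨ sym (+-assoc (xs i) (xs j) rest) ⟩
  (xs i + xs j) + rest                   ∎
  where
  open ≡-Reasoning
  rest = sum (zeroAt (zeroAt xs i) j)

zeroAt-cong : ∀ {n} {xs ys : Vector ℕ n} {i k} → (k ≢ i → xs k ≡ ys k) → zeroAt xs i k ≡ zeroAt ys i k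
zeroAt-cong {xs = xs} {ys} {i} {k} agree with k ≟ i
... | yes refl = trans (updateAt-updates k xs) (sym (updateAt-updates k ys))
... | no k≢i   = trans (updateAt-minimal k i xs k≢i) (trans (agree k≢i) (sym (updateAt-minimal k i ys k≢i)))

zeroAt₂-cong : ∀ {n} {xs ys : Vector ℕ n} {i j} → (∀ k → k ≢ i → k ≢ j → xs k ≡ ys k)
  → zeroAt (zeroAt xs i) j ≗ zeroAt (zeroAt ys i) j
zeroAt₂-cong agree k = zeroAt-cong λ k≢j → zeroAt-cong λ k≢i → agree k k≢i k≢j

sum-<-at₂ : ∀ {n} {xs ys : Vector ℕ n} {i j} → i ≢ j → (∀ k → k ≢ i → k ≢ j → xs k ≡ ys k)
  → xs i + xs j < ys i + ys j → sum xs < sum ys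
sum-<-at₂ {xs = xs} {ys} {i} {j} i≢j agree lt = begin-strict
  sum xs                                           ≡⟨ sum-zeroAt₂ xs i≢j ⟩
  (xs i + xs j) + sum (zeroAt (zeroAt xs i) j)     <⟨ +-monoˡ-< _ lt ⟩
  (ys i + ys j) + sum (zeroAt (zeroAt xs i) j)     ≡⟨ cong ((ys i + ys j) +_) (sum-cong-≗ (zeroAt₂-cong agree)) ⟩
  (ys i + ys j) + sum (zeroAt (zeroAt ys i) j)     ≡⟨ sym (sum-zeroAt₂ ys i≢j) ⟩
  sum ys                                           ∎
  where open ≤-Reasoning

potential-relabel : ∀ {m c} {S S′ : Config m c} (π : Permutation′ m) → S ≗ S′ ∘ (π ⟨$⟩ʳ_)
  → potential S ≡ potential S′
potential-relabel {S′ = S′} π S≗S′∘π =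
  trans (sum-cong-≗ (cong binPotential ∘ S≗S′∘π)) (sym (sum-permute (binPotential ∘ S′) π))

≗-transpose : ∀ {m} {A : Set} {f g : Fin m → A} {i j : Fin m}
  → f i ≡ g j → f j ≡ g i → (∀ k → k ≢ i → k ≢ j → f k ≡ g k) → f ≗ g ∘ (transpose i j ⟨$⟩ʳ_)
≗-transpose {i = i} {j} fi≡gj fj≡gi agree k with k ≟ i
... | yes refl = fi≡gj
... | no k≢i with k ≟ j
...   | yes refl = fj≡gi
...   | no k≢j = agree k k≢i k≢j

module _ {m c h : ℕ} (π : Permutation′ m) where

  waterMove-relabel : ∀ {S₀ S S′ : Config m c} → S₀ ≗ S ∘ (π ⟨$⟩ʳ_)
    → WaterMove h S S′ → WaterMove h S₀ (S′ ∘ (π ⟨$⟩ʳ_))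
  waterMove-relabel {S₀} {S} {S′} S₀≗S∘π w = record
    { b₁       = π ⟨$⟩ˡ b₁
    ; b₂       = π ⟨$⟩ˡ b₂
    ; distinct = λ e → distinct (trans (sym (inverseʳ π)) (trans (cong (π ⟨$⟩ʳ_) e) (inverseʳ π)))
    ; col      = col
    ; k        = k
    ; pre      = pre
    ; k≥1      = k≥1
    ; src      = trans (relabelled b₁) src
    ; tgtOK    = subst (λ xs → xs ≡ [] ⊎ TopIs xs col) (sym (relabelled b₂)) tgtOK
    ; fits     = subst (λ xs → length xs + k ≤ h) (sym (relabelled b₂)) fits
    ; newSrc   = trans (cong S′ (inverseʳ π)) newSrc
    ; newTgt   = trans (cong S′ (inverseʳ π)) (trans newTgt (cong (_++ replicate k col) (sym (relabelled b₂))))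
    ; others   = λ b b≢₁ b≢₂ → trans (others (π ⟨$⟩ʳ b) (moved b≢₁) (moved b≢₂)) (sym (S₀≗S∘π b))
    ; maximal  = map₂ (trans (cong (length ∘ S′) (inverseʳ π))) maximal
    }
    where
    open WaterMove w
    relabelled : ∀ b → S₀ (π ⟨$⟩ˡ b) ≡ S b
    relabelled b = trans (S₀≗S∘π (π ⟨$⟩ˡ b)) (cong S (inverseʳ π))
    moved : ∀ {b b′} → b ≢ π ⟨$⟩ˡ b′ → π ⟨$⟩ʳ b ≢ b′
    moved b≢ e = b≢ (trans (sym (inverseˡ π)) (cong (π ⟨$⟩ˡ_) e))

  moves-relabel : ∀ {l} {S₀ S T : Config m c} → S₀ ≗ S ∘ (π ⟨$⟩ʳ_)
    → Moves h l S T → ∃[ T₀ ] (Moves h l S₀ T₀ × T₀ ≗ T ∘ (π ⟨$⟩ʳ_))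
  moves-relabel {S₀ = S₀} S₀≗S∘π done = S₀ , done , S₀≗S∘π
  moves-relabel S₀≗S∘π (step w ms) =
    let T₀ , ms₀ , T₀≗T∘π = moves-relabel (λ _ → refl) ms
    in T₀ , step (waterMove-relabel S₀≗S∘π w) ms₀ , T₀≗T∘π

sorted-relabel : ∀ {m m′ c h} {T₀ : Config m′ c} {T : Config m c} (σ : Fin m′ → Fin m)
  → T₀ ≗ T ∘ σ → Sorted h T → Sorted h T₀
sorted-relabel {h = h} σ T₀≗T∘σ sorted b =
  subst (λ xs → xs ≡ [] ⊎ ∃[ col ] xs ≡ replicate h col) (sym (T₀≗T∘σ b)) (sorted (σ b))

WithinCapacity : ∀ {m c} → ℕ → Config m c → Set
WithinCapacity {m} h S = ∀ (b : Fin m) → length (S b) ≤ h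

waterMove-withinCapacity : ∀ {m c h} {S S′ : Config m c}
  → WithinCapacity h S → WaterMove h S S′ → WithinCapacity h S′
waterMove-withinCapacity {h = h} {S} {S′} cap w b = capacityAt (b ≟ b₁) (b ≟ b₂)
  where
  open WaterMove w
  capacityAt : Dec (b ≡ b₁) → Dec (b ≡ b₂) → length (S′ b) ≤ h
  capacityAt (yes refl) _ = subst (λ xs → length xs ≤ h) (sym newSrc)
    (≤-trans (length-++-≤ˡ pre) (subst (λ xs → length xs ≤ h) src (cap b)))
  capacityAt (no _) (yes refl) = subst (λ xs → length xs ≤ h) (sym newTgt)
    (subst (_≤ h) (sym (trans (length-++ (S b)) (cong (length (S b) +_) (length-replicate k)))) fits)
  capacityAt (no b≢₁) (no b≢₂) = subst (λ xs → length xs ≤ h) (sym (others b b≢₁ b≢₂)) (cap b)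

data MoveEffect {c} (A B A′ B′ : List (Fin c)) : Set where
  swaps  : A′ ≡ B → B′ ≡ A → MoveEffect A B A′ B′
  lowers : binPotential A′ + binPotential B′ < binPotential A + binPotential B → MoveEffect A B A′ B′

pourIntoEmpty : ∀ {c} (pre : List (Fin c)) (col : Fin c) (k : ℕ)
  → length (pre ++ replicate (suc k) col) ≤ 2
  → ¬ TopIs pre col ⊎ length (replicate (suc k) col) ≡ 2
  → MoveEffect (pre ++ replicate (suc k) col) [] pre (replicate (suc k) col)
pourIntoEmpty []      col zero           _                   _ = swaps refl refl
pourIntoEmpty []      col (suc zero)     _                   _ = swaps refl refl
pourIntoEmpty []      col (suc (suc k))  (s≤s (s≤s ()))      _
pourIntoEmpty (z ∷ []) col zero          _ (inj₁ z-not-top) =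
  lowers (≤-reflexive (sym (cong (_+ 0) (binPotential-mixed {x = z} {col} λ { refl → z-not-top ([] , refl) }))))
pourIntoEmpty (z ∷ []) col zero          _ (inj₂ ())
pourIntoEmpty (z ∷ []) col (suc k)       (s≤s (s≤s ()))      _
pourIntoEmpty (_ ∷ _ ∷ [])    col k      (s≤s (s≤s ()))      _
pourIntoEmpty (_ ∷ _ ∷ _ ∷ _) col k      (s≤s (s≤s ()))      _

pourOntoTop : ∀ {c} (pre ys : List (Fin c)) (col : Fin c) (k : ℕ)
  → length (ys ++ [ col ]) + suc k ≤ 2
  → length (pre ++ replicate (suc k) col) ≤ 2
  → MoveEffect (pre ++ replicate (suc k) col) (ys ++ [ col ]) pre ((ys ++ [ col ]) ++ replicate (suc k) col)
pourOntoTop []       [] col zero _ _ =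
  lowers (subst (_< 2) (sym (binPotential-sorted col)) (s≤s z≤n))
pourOntoTop (z ∷ []) [] col zero _ _ with z ≟ col
... | yes refl = swaps refl refl
... | no z≢col = lowers (subst₂ (λ p q → 1 + p < q + 1)
                   (sym (binPotential-sorted col)) (sym (binPotential-mixed z≢col)) (s≤s (s≤s z≤n)))
pourOntoTop (_ ∷ _ ∷ [])    [] col zero  _ (s≤s (s≤s ()))
pourOntoTop (_ ∷ _ ∷ _ ∷ _) [] col zero  _ (s≤s (s≤s ()))
pourOntoTop pre [] col (suc k) (s≤s (s≤s ())) _
pourOntoTop pre (_ ∷ []) col k (s≤s (s≤s ())) _
pourOntoTop pre (_ ∷ _ ∷ ys) col k (s≤s (s≤s fits)) _ with m+n≤o⇒n≤o (length (ys ++ [ col ])) fits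
... | ()

pourEffect : ∀ {c} (pre B : List (Fin c)) (col : Fin c) (k : ℕ) → 1 ≤ k
  → B ≡ [] ⊎ TopIs B col → length B + k ≤ 2 → length (pre ++ replicate k col) ≤ 2
  → ¬ TopIs pre col ⊎ length (B ++ replicate k col) ≡ 2
  → MoveEffect (pre ++ replicate k col) B pre (B ++ replicate k col)
pourEffect pre .[] col (suc k) _ (inj₁ refl) _ source≤2 maximal =
  pourIntoEmpty pre col k source≤2 maximal
pourEffect pre .(ys ++ [ col ]) col (suc k) _ (inj₂ (ys , refl)) fits source≤2 _ =
  pourOntoTop pre ys col k fits source≤2

waterMove-effect : ∀ {m c} {S S′ : Config m c} → WithinCapacity 2 S → (w : WaterMove 2 S S′)
  → let open WaterMove w in MoveEffect (S b₁) (S b₂) (S′ b₁) (S′ b₂)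
waterMove-effect {S = S} {S′} cap w
  rewrite WaterMove.src w | WaterMove.newSrc w | WaterMove.newTgt w =
  pourEffect pre (S b₂) col k k≥1 tgtOK fits
    (subst (λ xs → length xs ≤ 2) src (cap b₁))
    (map₂ (trans (cong length (sym newTgt))) maximal)
  where open WaterMove w

waterMove-relabels-or-lowers : ∀ {m c} {S S′ : Config m c} → WithinCapacity 2 S → WaterMove 2 S S′
  → (∃[ π ] S ≗ S′ ∘ (π ⟨$⟩ʳ_)) ⊎ potential S′ < potential S
waterMove-relabels-or-lowers {S = S} {S′} cap w = classify (waterMove-effect cap w)
  where
  open WaterMove w
  classify : MoveEffect (S b₁) (S b₂) (S′ b₁) (S′ b₂)
    → (∃[ π ] S ≗ S′ ∘ (π ⟨$⟩ʳ_)) ⊎ potential S′ < potential S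
  classify (swaps S′b₁≡Sb₂ S′b₂≡Sb₁) = inj₁ (transpose b₁ b₂ ,
    ≗-transpose (sym S′b₂≡Sb₁) (sym S′b₁≡Sb₂) λ b b≢₁ b≢₂ → sym (others b b≢₁ b≢₂))
  classify (lowers lowered) =
    inj₂ (sum-<-at₂ distinct (λ b b≢₁ b≢₂ → cong binPotential (others b b≢₁ b≢₂)) lowered)

shorten : ∀ {m c l} {S T : Config m c} → WithinCapacity 2 S → Moves 2 l S T → Sorted 2 T
  → ∃[ l′ ] ∃[ T′ ] (Moves 2 l′ S T′ × Sorted 2 T′ × l′ ≤ potential S)
shorten cap done sorted = 0 , _ , done , sorted , z≤n
shorten cap (step {S' = S′} w ms) sorted
  with shorten (waterMove-withinCapacity cap w) ms sorted | waterMove-relabels-or-lowers cap w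
... | l′ , T′ , ms′ , sorted′ , l′≤ | inj₁ (π , S≗S′∘π) =
  let T₀ , ms₀ , T₀≗T′∘π = moves-relabel π S≗S′∘π ms′
  in l′ , T₀ , ms₀ , sorted-relabel (π ⟨$⟩ʳ_) T₀≗T′∘π sorted′ ,
     ≤-trans l′≤ (≤-reflexive (sym (potential-relabel {S′ = S′} π S≗S′∘π)))
... | l′ , T′ , ms′ , sorted′ , l′≤ | inj₂ lowered =
  suc l′ , T′ , step w ms′ , sorted′ , ≤-trans (s≤s l′≤) lowered

sum≡listSum-tabulate : ∀ {n} (xs : Vector ℕ n) → sum xs ≡ listSum (tabulate xs)
sum≡listSum-tabulate {zero}  xs = refl
sum≡listSum-tabulate {suc n} xs = cong (xs zero +_) (sum≡listSum-tabulate (xs ∘ suc))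

listSum-map-≤-count : ∀ {a p} {A : Set a} {P : Pred A p} (P? : Decidable P) (f : A → ℕ) {bound : ℕ}
  → (∀ x → f x ≤ bound) → (∀ x → ¬ P x → f x ≡ 0)
  → ∀ xs → listSum (map f xs) ≤ bound * length (filter P? xs)
listSum-map-≤-count P? f f≤ f≡0 [] = z≤n
listSum-map-≤-count P? f {bound} f≤ f≡0 (x ∷ xs) with P? x
... | yes _ = ≤-trans (+-mono-≤ (f≤ x) (listSum-map-≤-count P? f f≤ f≡0 xs))
                      (≤-reflexive (sym (*-suc bound _)))
... | no ¬px rewrite f≡0 x ¬px = listSum-map-≤-count P? f f≤ f≡0 xs

potential≤3*numFull : ∀ {m c} (S : Config m c) → (∀ b → length (S b) ≡ 2 ⊎ length (S b) ≡ 0)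
  → potential S ≤ 3 * numFull 2 S
potential≤3*numFull {m} S fullOrEmpty = begin
  potential S                                   ≡⟨ sum≡listSum-tabulate (binPotential ∘ S) ⟩
  listSum (tabulate (binPotential ∘ S))         ≡⟨ cong listSum (sym (map-tabulate id (binPotential ∘ S))) ⟩
  listSum (map (binPotential ∘ S) (allFin m))   ≤⟨ listSum-map-≤-count (λ b → length (S b) ≟ℕ 2)
                                                     (binPotential ∘ S) (binPotential≤3 ∘ S) notFull⇒0 (allFin m) ⟩
  3 * numFull 2 S                               ∎
  where
  open ≤-Reasoning
  empty⇒0 : ∀ {c} (xs : List (Fin c)) → length xs ≡ 0 → binPotential xs ≡ 0
  empty⇒0 [] _ = refl
  notFull⇒0 : ∀ b → length (S b) ≢ 2 → binPotential (S b) ≡ 0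
  notFull⇒0 b notFull with fullOrEmpty b
  ... | inj₁ full  = ⊥-elim (notFull full)
  ... | inj₂ empty = empty⇒0 (S b) empty

corollary13 : ∃[ a ] ∃[ d ] (∀ (n k m : ℕ) (S : Config m n) → IsInstance 2 n k S → Solvable 2 S
    → ∃[ l ] ∃[ S' ] (Moves 2 l S S' × Sorted 2 S' × l ≤ a * n + d))
corollary13 = 3 , 0 , sortWithin3n
  where
  sortWithin3n : ∀ (n k m : ℕ) (S : Config m n) → IsInstance 2 n k S → Solvable 2 S
    → ∃[ l ] ∃[ S' ] (Moves 2 l S S' × Sorted 2 S' × l ≤ 3 * n + 0)
  sortWithin3n n k m S isInstance (_ , _ , ms , sorted) =
    let l , S′ , ms′ , sorted′ , l≤ = shorten withinCapacity ms sorted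
    in l , S′ , ms′ , sorted′ , (begin
         l                 ≤⟨ l≤ ⟩
         potential S       ≤⟨ potential≤3*numFull S fullOrEmpty ⟩
         3 * numFull 2 S   ≡⟨ cong (3 *_) nFull ⟩
         3 * n             ≡⟨ sym (+-identityʳ (3 * n)) ⟩
         3 * n + 0         ∎)
    where
    open IsInstance isInstance
    open ≤-Reasoning
    withinCapacity : WithinCapacity 2 S
    withinCapacity b with fullOrEmpty b
    ... | inj₁ full  = ≤-reflexive full
    ... | inj₂ empty = subst (_≤ 2) (sym empty) z≤n
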